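{- Let $T$ be a plane rooted tree. Then (i) $Q(T)$ is a (possibly empty) product of $q$-binomial coefficients $\binom{a+b}{a}_q$ with integers $a,b\ge 0$; and (ii) $Q(T)$ is a (possibly empty) product of cyclotomic polynomials in $q$.
   Context: A plane rooted tree is a finite tree with a distinguished vertex (the root), embedded in the plane so that it grows upward from the root. A leaf is a vertex of degree $1$ different from the root. For a leaf $v$ of $T$, $r(T,v)$ denotes the number of edges of $T$ lying to the right of the unique path connecting $v$ with the root, and $T-v$ is the plane rooted tree obtained by deleting $v$ and its incident edge. The plucking polynomial $Q(T)\in\mathbb{Z}[q]$ is defined recursively: if $T$ has a single vertex then $Q(T)=1$; otherwise $Q(T)=\sum_{v \text{ leaf of } T} q^{r(T,v)}Q(T-v)$. Notation: $[n]_q=1+q+\dots+q^{n-1}$, $[0]_q!=1$, $[n]_q!=[n]_q\cdots[1]_q$, $\binom{a+b}{a}_q=\frac{[a+b]_q!}{[a]_q![b]_q!}$. The $n$th cyclotomic polynomial is $\Psi_n(q)=\prod_{\omega}(q-\omega)$ over primitive $n$th roots of unity $\omega$. -}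

module Defs where

open import Data.Nat as ℕ using (ℕ; zero; suc; _≥_)
open import Data.Nat.Divisibility using (_∣?_)
open import Data.Integer as ℤ using (ℤ; +_; -[1+_])
open import Data.List using (List; []; _∷_; _++_; map; foldr; replicate; filter; upTo)
open import Data.Product using (Σ; _×_; _,_)
open import Data.List.Relation.Unary.All using (All)
open import Relation.Binary.PropositionalEquality using (_≡_)

-- Polynomials in ℤ[q], as coefficient lists (lowest degree first).

Poly : Set
Poly = List ℤ

infixl 6 _+ₚ_
infixl 7 _*ₚ_
infix 4 _≈ₚ_

_+ₚ_ : Poly → Poly → Poly
[] +ₚ q = q
(a ∷ p) +ₚ [] = a ∷ p
(a ∷ p) +ₚ (b ∷ q) = (a ℤ.+ b) ∷ (p +ₚ q)

scaleₚ : ℤ → Poly → Poly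
scaleₚ a p = map (a ℤ.*_) p

_*ₚ_ : Poly → Poly → Poly
[] *ₚ q = []
(a ∷ p) *ₚ q = scaleₚ a q +ₚ (+ 0 ∷ (p *ₚ q))

coeff : Poly → ℕ → ℤ
coeff [] i = + 0
coeff (a ∷ p) zero = a
coeff (a ∷ p) (suc i) = coeff p i

-- equality of polynomials: all coefficients agree (ignores trailing zeros)
_≈ₚ_ : Poly → Poly → Set
p ≈ₚ q = ∀ i → coeff p i ≡ coeff q i

0ₚ : Poly
0ₚ = []

1ₚ : Poly
1ₚ = + 1 ∷ []

shiftₚ : ℕ → Poly → Poly
shiftₚ r p = replicate r (+ 0) ++ p

qpow : ℕ → Poly
qpow n = shiftₚ n 1ₚ

sumₚ : List Poly → Poly
sumₚ = foldr _+ₚ_ 0ₚ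

prodₚ : List Poly → Poly
prodₚ = foldr _*ₚ_ 1ₚ

qint : ℕ → Poly
qint n = replicate n (+ 1)

qfact : ℕ → Poly
qfact zero = 1ₚ
qfact (suc n) = qint (suc n) *ₚ qfact n

-- P is the q-binomial coefficient (a+b choose a)_q = [a+b]_q!/([a]_q![b]_q!),
-- i.e. P · [a]_q! · [b]_q! = [a+b]_q!  (ℤ[q] is a domain, so P is determined).
IsQBinomial : Poly → Set
IsQBinomial P = Σ ℕ λ a → Σ ℕ λ b → P *ₚ qfact a *ₚ qfact b ≈ₚ qfact (a ℕ.+ b)

divisors : ℕ → List ℕ
divisors n = filter (λ d → d ∣? n) (map suc (upTo n))

-- C is the family of cyclotomic polynomials: for all n ≥ 1,
--   ∏_{d ∣ n} C d = q^n − 1.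
-- (This determines C n uniquely for every n ≥ 1, by strong induction,
-- and is satisfied by Ψ_n(q) = ∏_{ω primitive n-th root of 1} (q − ω).)
IsCyclotomicFamily : (ℕ → Poly) → Set
IsCyclotomicFamily C =
  ∀ n → n ≥ 1 → prodₚ (map C (divisors n)) ≈ₚ (qpow n +ₚ (-[1+ 0 ] ∷ []))

IsProductOf : (Poly → Set) → Poly → Set
IsProductOf R P = Σ (List Poly) λ Ps → All R Ps × (P ≈ₚ prodₚ Ps)

-- Plane rooted trees: a vertex with its ordered (left-to-right) list of
-- children subtrees.

data Tree : Set where
  node : List Tree → Tree

mutual
  edges : Tree → ℕ
  edges (node ts) = edgesL ts

  -- number of edges in a list of sibling subtrees, including the edges
  -- joining them to their parent
  edgesL : List Tree → ℕ
  edgesL [] = 0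
  edgesL (t ∷ ts) = suc (edges t) ℕ.+ edgesL ts

-- Given the children list ts of a vertex u, list all leaves v of the
-- subtree at u other than u itself, as pairs
--   (number of edges to the right of the path from v up to u, ts after deleting v).
-- A child with no children is a leaf; its edges to the right are exactly
-- the edges of the subtrees hanging to its right (with their joining edges).
plucks : List Tree → List (ℕ × List Tree)
plucks [] = []
plucks (node [] ∷ ts) =
  (edgesL ts , ts) ∷ map (λ { (r , ts') → (r , node [] ∷ ts') }) (plucks ts)
plucks (node (c ∷ cs) ∷ ts) =
  map (λ { (r , cs') → (r ℕ.+ edgesL ts , node cs' ∷ ts) }) (plucks (c ∷ cs))
  ++ map (λ { (r , ts') → (r , node (c ∷ cs) ∷ ts') }) (plucks ts)

-- leaves of T (the root is never a leaf), with r(T,v) and T − v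
leaves : Tree → List (ℕ × Tree)
leaves (node ts) = map (λ { (r , ts') → (r , node ts') }) (plucks ts)

Qfuel : ℕ → Tree → Poly
Qfuel zero T = 1ₚ
Qfuel (suc n) (node []) = 1ₚ
Qfuel (suc n) (node (t ∷ ts)) =
  sumₚ (map (λ { (r , T') → shiftₚ r (Qfuel n T') }) (leaves (node (t ∷ ts))))

-- Q(T); T − v has one edge fewer, so fuel = edges T suffices
Q : Tree → Poly
Q T = Qfuel (edges T) T

{-# OPTIONS --safe #-}

-- Write T = node (t ∷ ts), where t has a edges and the branches ts, with their root edges,
-- have b edges.  Then Q T = qbin (a + 1) b · Q t · Q (node ts), by induction on the
-- number of edges: the leaves lying in t contribute q^b · qbin a b · Q t · Q (node ts), those
-- lying in ts contribute qbin (a + 1) (b − 1) · Q t · Q (node ts), and the q-Pascal rule adds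
-- the two up.  Iterating gives (i).
-- For (ii), ∏_{k ≤ n} (q^k − 1) equals both (q − 1)^n [n]_q! and ∏_d Ψ_d^⌊n/d⌋, since
-- q^k − 1 = ∏_{d ∣ k} Ψ_d.  Cancelling in ℤ[q] gives
-- (a+b choose a)_q = ∏_d Ψ_d^(⌊(a+b)/d⌋ − ⌊a/d⌋ − ⌊b/d⌋), with non-negative exponents.

module Submission where

open import Defs
open import Data.Nat as ℕ using (ℕ; zero; suc; _≥_; _≤_; _<_; z≤n; s≤s)
import Data.Nat.Properties as ℕP
open import Data.Nat.Divisibility using (_∣?_; divides; ∣⇒≤; 0∣⇒≡0)
open import Data.Integer as ℤ using (ℤ; +_; -[1+_])
import Data.Integer.Properties as ℤP
open import Data.List using (List; []; _∷_; _++_; map; replicate; filter; upTo)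
import Data.List.Properties as ListP
open import Data.List.Relation.Unary.All as All using (All; []; _∷_)
import Data.List.Relation.Unary.All.Properties as AllP
open import Data.Product using (Σ; _×_; _,_; proj₁; proj₂)
open import Data.Sum using (inj₁; inj₂)
open import Data.Maybe as Maybe using (Maybe; just; nothing)
open import Data.Empty using (⊥-elim)
open import Relation.Nullary using (¬_; yes; no)
open import Relation.Binary.PropositionalEquality
  using (_≡_; refl; sym; trans; cong; cong₂; subst)
open import Relation.Binary.Bundles using (Setoid)
open import Algebra.Bundles using (CommutativeRing)
open import Tactic.RingSolver.Core.AlmostCommutativeRing
  using (AlmostCommutativeRing; fromCommutativeRing)
open import Tactic.RingSolver using (solve-∀)

module Polynomial where

  -- Wrapping _≈ₚ_ in a record makes it injective, so both sides can be
  -- inferred from a proof; the setoid combinators and the ring solver need this.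
  infix 4 _≈_
  record _≈_ (p q : Poly) : Set where
    constructor mk
    field get : p ≈ₚ q
  open _≈_ public

  ≈-refl : ∀ {p} → p ≈ p
  ≈-refl = mk λ i → refl

  ≈-sym : ∀ {p q} → p ≈ q → q ≈ p
  ≈-sym (mk e) = mk λ i → sym (e i)

  ≈-trans : ∀ {p q r} → p ≈ q → q ≈ r → p ≈ r
  ≈-trans (mk e) (mk f) = mk λ i → trans (e i) (f i)

  ≈-setoid : Setoid _ _
  ≈-setoid = record
    { Carrier = Poly ; _≈_ = _≈_
    ; isEquivalence = record { refl = ≈-refl ; sym = ≈-sym ; trans = ≈-trans } }

  ≡⇒≈ : ∀ {p q} → p ≡ q → p ≈ q
  ≡⇒≈ refl = ≈-refl

  coeff-+ : ∀ p q i → coeff (p +ₚ q) i ≡ coeff p i ℤ.+ coeff q i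
  coeff-+ []      q       i       = sym (ℤP.+-identityˡ _)
  coeff-+ (a ∷ p) []      i       = sym (ℤP.+-identityʳ _)
  coeff-+ (a ∷ p) (b ∷ q) zero    = refl
  coeff-+ (a ∷ p) (b ∷ q) (suc i) = coeff-+ p q i

  coeff-scale : ∀ a p i → coeff (scaleₚ a p) i ≡ a ℤ.* coeff p i
  coeff-scale a []      i       = sym (ℤP.*-zeroʳ a)
  coeff-scale a (b ∷ p) zero    = refl
  coeff-scale a (b ∷ p) (suc i) = coeff-scale a p i

  ∷-cong : ∀ {a b p q} → a ≡ b → p ≈ q → (a ∷ p) ≈ (b ∷ q)
  ∷-cong a≡b (mk p≈q) = mk λ { zero → a≡b ; (suc i) → p≈q i }

  ∷-≈[]⁻¹ : ∀ {a p} → (a ∷ p) ≈ [] → p ≈ []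
  ∷-≈[]⁻¹ (mk e) = mk λ i → e (suc i)

  ∷-≈[] : ∀ {a p} → a ≡ + 0 → p ≈ [] → (a ∷ p) ≈ []
  ∷-≈[] a≡0 (mk e) = mk λ { zero → a≡0 ; (suc i) → e i }

  +-cong : ∀ {p p′ q q′} → p ≈ p′ → q ≈ q′ → p +ₚ q ≈ p′ +ₚ q′
  +-cong {p} {p′} {q} {q′} (mk e) (mk f) = mk λ i →
    trans (coeff-+ p q i) (trans (cong₂ ℤ._+_ (e i) (f i)) (sym (coeff-+ p′ q′ i)))

  +-congˡ : ∀ {p p′} q → p ≈ p′ → p +ₚ q ≈ p′ +ₚ q
  +-congˡ q e = +-cong e ≈-refl

  +-congʳ : ∀ p {q q′} → q ≈ q′ → p +ₚ q ≈ p +ₚ q′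
  +-congʳ p e = +-cong ≈-refl e

  +-assoc : ∀ p q r → (p +ₚ q) +ₚ r ≈ p +ₚ (q +ₚ r)
  +-assoc []      q       r       = ≈-refl
  +-assoc (a ∷ p) []      r       = ≈-refl
  +-assoc (a ∷ p) (b ∷ q) []      = ≈-refl
  +-assoc (a ∷ p) (b ∷ q) (c ∷ r) = ∷-cong (ℤP.+-assoc a b c) (+-assoc p q r)

  +-comm : ∀ p q → p +ₚ q ≈ q +ₚ p
  +-comm []      []      = ≈-refl
  +-comm []      (b ∷ q) = ≈-refl
  +-comm (a ∷ p) []      = ≈-refl
  +-comm (a ∷ p) (b ∷ q) = ∷-cong (ℤP.+-comm a b) (+-comm p q)

  +-identityʳ : ∀ p → p +ₚ [] ≈ p
  +-identityʳ []      = ≈-refl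
  +-identityʳ (a ∷ p) = ≈-refl

  +-interchange : ∀ p q r s → (p +ₚ q) +ₚ (r +ₚ s) ≈ (p +ₚ r) +ₚ (q +ₚ s)
  +-interchange p q r s = begin
    (p +ₚ q) +ₚ (r +ₚ s)   ≈⟨ +-assoc p q (r +ₚ s) ⟩
    p +ₚ (q +ₚ (r +ₚ s))   ≈⟨ +-congʳ p (≈-sym (+-assoc q r s)) ⟩
    p +ₚ ((q +ₚ r) +ₚ s)   ≈⟨ +-congʳ p (+-congˡ s (+-comm q r)) ⟩
    p +ₚ ((r +ₚ q) +ₚ s)   ≈⟨ +-congʳ p (+-assoc r q s) ⟩
    p +ₚ (r +ₚ (q +ₚ s))   ≈⟨ ≈-sym (+-assoc p r (q +ₚ s)) ⟩
    (p +ₚ r) +ₚ (q +ₚ s)   ∎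
    where open import Relation.Binary.Reasoning.Setoid ≈-setoid

  scale-cong : ∀ a {p q} → p ≈ q → scaleₚ a p ≈ scaleₚ a q
  scale-cong a {p} {q} (mk e) = mk λ i →
    trans (coeff-scale a p i) (trans (cong (a ℤ.*_) (e i)) (sym (coeff-scale a q i)))

  scale-distribˡ : ∀ a p q → scaleₚ a (p +ₚ q) ≈ scaleₚ a p +ₚ scaleₚ a q
  scale-distribˡ a []      q       = ≈-refl
  scale-distribˡ a (b ∷ p) []      = ≈-refl
  scale-distribˡ a (b ∷ p) (c ∷ q) = ∷-cong (ℤP.*-distribˡ-+ a b c) (scale-distribˡ a p q)

  scale-distribʳ : ∀ a b p → scaleₚ (a ℤ.+ b) p ≈ scaleₚ a p +ₚ scaleₚ b p
  scale-distribʳ a b []      = ≈-refl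
  scale-distribʳ a b (c ∷ p) = ∷-cong (ℤP.*-distribʳ-+ c a b) (scale-distribʳ a b p)

  scale-assoc : ∀ a b p → scaleₚ a (scaleₚ b p) ≈ scaleₚ (a ℤ.* b) p
  scale-assoc a b []      = ≈-refl
  scale-assoc a b (c ∷ p) = ∷-cong (sym (ℤP.*-assoc a b c)) (scale-assoc a b p)

  scale-zero : ∀ p → scaleₚ (+ 0) p ≈ []
  scale-zero []      = ≈-refl
  scale-zero (a ∷ p) = ∷-≈[] refl (scale-zero p)

  scale-one : ∀ p → scaleₚ (+ 1) p ≈ p
  scale-one []      = ≈-refl
  scale-one (a ∷ p) = ∷-cong (ℤP.*-identityˡ a) (scale-one p)

  negₚ : Poly → Poly
  negₚ = map (ℤ.-_)

  neg-cong : ∀ {p q} → p ≈ q → negₚ p ≈ negₚ q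
  neg-cong {p} {q} (mk e) = mk λ i → trans (coeff-neg p i) (trans (cong ℤ.-_ (e i)) (sym (coeff-neg q i)))
    where
    coeff-neg : ∀ p i → coeff (negₚ p) i ≡ ℤ.- coeff p i
    coeff-neg []      i       = refl
    coeff-neg (a ∷ p) zero    = refl
    coeff-neg (a ∷ p) (suc i) = coeff-neg p i

  +-inverseʳ : ∀ p → p +ₚ negₚ p ≈ []
  +-inverseʳ []      = ≈-refl
  +-inverseʳ (a ∷ p) = ∷-≈[] (ℤP.+-inverseʳ a) (+-inverseʳ p)

  +-inverseˡ : ∀ p → negₚ p +ₚ p ≈ []
  +-inverseˡ p = ≈-trans (+-comm (negₚ p) p) (+-inverseʳ p)

  *-zeroʳ : ∀ p → p *ₚ [] ≈ []
  *-zeroʳ []      = ≈-refl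
  *-zeroʳ (a ∷ p) = ∷-≈[] refl (*-zeroʳ p)

  *-congʳ : ∀ p {q q′} → q ≈ q′ → p *ₚ q ≈ p *ₚ q′
  *-congʳ []      e = ≈-refl
  *-congʳ (a ∷ p) e = +-cong (scale-cong a e) (∷-cong refl (*-congʳ p e))

  *-identityˡ : ∀ p → 1ₚ *ₚ p ≈ p
  *-identityˡ p = ≈-trans (+-cong (scale-one p) (∷-≈[] refl ≈-refl)) (+-identityʳ p)

  0∷-* : ∀ p q → (+ 0 ∷ p) *ₚ q ≈ (+ 0 ∷ (p *ₚ q))
  0∷-* p q = +-congˡ _ (scale-zero q)

  *-∷ : ∀ p b q → p *ₚ (b ∷ q) ≈ scaleₚ b p +ₚ (+ 0 ∷ (p *ₚ q))
  *-∷ []      b q = ≈-sym (∷-≈[] refl ≈-refl)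
  *-∷ (a ∷ p) b q = ∷-cong (cong (ℤ._+ + 0) (ℤP.*-comm a b)) (begin
    scaleₚ a q +ₚ p *ₚ (b ∷ q)                       ≈⟨ +-congʳ (scaleₚ a q) (*-∷ p b q) ⟩
    scaleₚ a q +ₚ (scaleₚ b p +ₚ (+ 0 ∷ (p *ₚ q)))   ≈⟨ ≈-sym (+-assoc (scaleₚ a q) _ _) ⟩
    (scaleₚ a q +ₚ scaleₚ b p) +ₚ (+ 0 ∷ (p *ₚ q))   ≈⟨ +-congˡ _ (+-comm (scaleₚ a q) _) ⟩
    (scaleₚ b p +ₚ scaleₚ a q) +ₚ (+ 0 ∷ (p *ₚ q))   ≈⟨ +-assoc (scaleₚ b p) _ _ ⟩
    scaleₚ b p +ₚ (scaleₚ a q +ₚ (+ 0 ∷ (p *ₚ q)))   ∎)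
    where open import Relation.Binary.Reasoning.Setoid ≈-setoid

  *-comm : ∀ p q → p *ₚ q ≈ q *ₚ p
  *-comm []      q = ≈-sym (*-zeroʳ q)
  *-comm (a ∷ p) q = ≈-trans (+-congʳ (scaleₚ a q) (∷-cong refl (*-comm p q))) (≈-sym (*-∷ q a p))

  *-congˡ : ∀ {p p′} q → p ≈ p′ → p *ₚ q ≈ p′ *ₚ q
  *-congˡ {p} {p′} q e = ≈-trans (*-comm p q) (≈-trans (*-congʳ q e) (*-comm q p′))

  *-cong : ∀ {p p′ q q′} → p ≈ p′ → q ≈ q′ → p *ₚ q ≈ p′ *ₚ q′
  *-cong {p′ = p′} {q = q} e f = ≈-trans (*-congˡ q e) (*-congʳ p′ f)

  *-identityʳ : ∀ p → p *ₚ 1ₚ ≈ p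
  *-identityʳ p = ≈-trans (*-comm p 1ₚ) (*-identityˡ p)

  *-distribʳ : ∀ r p q → (p +ₚ q) *ₚ r ≈ (p *ₚ r) +ₚ (q *ₚ r)
  *-distribʳ r []      q       = ≈-refl
  *-distribʳ r (a ∷ p) []      = ≈-sym (+-identityʳ _)
  *-distribʳ r (a ∷ p) (b ∷ q) = ≈-trans
    (+-cong (scale-distribʳ a b r) (∷-cong refl (*-distribʳ r p q)))
    (+-interchange (scaleₚ a r) (scaleₚ b r) (+ 0 ∷ (p *ₚ r)) (+ 0 ∷ (q *ₚ r)))

  *-distribˡ : ∀ p q r → p *ₚ (q +ₚ r) ≈ (p *ₚ q) +ₚ (p *ₚ r)
  *-distribˡ p q r = ≈-trans (*-comm p _) (≈-trans (*-distribʳ p q r) (+-cong (*-comm q p) (*-comm r p)))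

  scale-* : ∀ a p q → scaleₚ a p *ₚ q ≈ scaleₚ a (p *ₚ q)
  scale-* a []      q = ≈-refl
  scale-* a (b ∷ p) q = ≈-trans
    (+-cong (≈-sym (scale-assoc a b q)) (∷-cong (sym (ℤP.*-zeroʳ a)) (scale-* a p q)))
    (≈-sym (scale-distribˡ a (scaleₚ b q) (+ 0 ∷ (p *ₚ q))))

  *-assoc : ∀ p q r → (p *ₚ q) *ₚ r ≈ p *ₚ (q *ₚ r)
  *-assoc []      q r = ≈-refl
  *-assoc (a ∷ p) q r = ≈-trans (*-distribʳ r (scaleₚ a q) _)
    (+-cong (scale-* a q r) (≈-trans (0∷-* (p *ₚ q) r) (∷-cong refl (*-assoc p q r))))

  Poly-commutativeRing : CommutativeRing _ _
  Poly-commutativeRing = record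
    { Carrier = Poly ; _≈_ = _≈_ ; _+_ = _+ₚ_ ; _*_ = _*ₚ_ ; -_ = negₚ ; 0# = [] ; 1# = 1ₚ
    ; isCommutativeRing = record
      { isRing = record
        { +-isAbelianGroup = record
          { isGroup = record
            { isMonoid = record
              { isSemigroup = record
                { isMagma = record { isEquivalence = Setoid.isEquivalence ≈-setoid ; ∙-cong = +-cong }
                ; assoc = +-assoc }
              ; identity = (λ p → ≈-refl) , +-identityʳ }
            ; inverse = +-inverseˡ , +-inverseʳ
            ; ⁻¹-cong = neg-cong }
          ; comm = +-comm }
        ; *-cong = *-cong
        ; *-assoc = *-assoc
        ; *-identity = *-identityˡ , *-identityʳ
        ; distrib = *-distribˡ , *-distribʳ }
      ; *-comm = *-comm } }

  Poly-ring : AlmostCommutativeRing _ _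
  Poly-ring = fromCommutativeRing Poly-commutativeRing 0≟_
    where
    -- the solver needs a (possibly incomplete) zero test to cancel terms
    0≟_ : ∀ p → Maybe ([] ≈ p)
    0≟ []          = just ≈-refl
    0≟ (+ 0 ∷ p)   = Maybe.map (λ 0≈p → ≈-sym (∷-≈[] refl (≈-sym 0≈p))) (0≟ p)
    0≟ (_ ∷ _)     = nothing

  shift≈qpow* : ∀ r p → shiftₚ r p ≈ qpow r *ₚ p
  shift≈qpow* zero    p = ≈-sym (*-identityˡ p)
  shift≈qpow* (suc r) p = ≈-trans (∷-cong refl (shift≈qpow* r p)) (≈-sym (0∷-* (qpow r) p))

  qpow-+ : ∀ m n → qpow (m ℕ.+ n) ≈ qpow m *ₚ qpow n
  qpow-+ zero    n = ≈-sym (*-identityˡ (qpow n))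
  qpow-+ (suc m) n = ≈-trans (∷-cong refl (qpow-+ m n)) (≈-sym (0∷-* (qpow m) (qpow n)))

  prod-++ : ∀ ps qs → prodₚ (ps ++ qs) ≈ prodₚ ps *ₚ prodₚ qs
  prod-++ []       qs = ≈-sym (*-identityˡ _)
  prod-++ (p ∷ ps) qs = ≈-trans (*-congʳ p (prod-++ ps qs)) (≈-sym (*-assoc p _ _))

  ConstNonZero : Poly → Set
  ConstNonZero p = ¬ (coeff p 0 ≡ + 0)

  coeff₀-* : ∀ p q → coeff (p *ₚ q) 0 ≡ coeff p 0 ℤ.* coeff q 0
  coeff₀-* []      q = refl
  coeff₀-* (a ∷ p) q = trans (coeff-+ (scaleₚ a q) (+ 0 ∷ (p *ₚ q)) 0)
                             (trans (ℤP.+-identityʳ _) (coeff-scale a q 0))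

  ConstNonZero-* : ∀ p q → ConstNonZero p → ConstNonZero q → ConstNonZero (p *ₚ q)
  ConstNonZero-* p q p₀≢0 q₀≢0 pq₀≡0
    with ℤP.i*j≡0⇒i≡0∨j≡0 (coeff p 0) (trans (sym (coeff₀-* p q)) pq₀≡0)
  ... | inj₁ p₀≡0 = p₀≢0 p₀≡0
  ... | inj₂ q₀≡0 = q₀≢0 q₀≡0

  *-cancelʳ-≈[] : ∀ p q → ConstNonZero q → p *ₚ q ≈ [] → p ≈ []
  *-cancelʳ-≈[] []      q q₀≢0 pq≈0 = ≈-refl
  *-cancelʳ-≈[] (a ∷ p) q q₀≢0 pq≈0
    with ℤP.i*j≡0⇒i≡0∨j≡0 a (trans (sym (coeff₀-* (a ∷ p) q)) (get pq≈0 0))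
  ... | inj₂ q₀≡0 = ⊥-elim (q₀≢0 q₀≡0)
  ... | inj₁ refl = ∷-≈[] refl
    (*-cancelʳ-≈[] p q q₀≢0 (∷-≈[]⁻¹ (≈-trans (≈-sym (0∷-* p q)) pq≈0)))

  *-cancelʳ : ∀ p p′ q → ConstNonZero q → p *ₚ q ≈ p′ *ₚ q → p ≈ p′
  *-cancelʳ p p′ q q₀≢0 e = begin
    p                         ≈⟨ x≈[x-y]+y p p′ ⟩
    (p +ₚ negₚ p′) +ₚ p′      ≈⟨ +-congˡ p′ (*-cancelʳ-≈[] (p +ₚ negₚ p′) q q₀≢0 difference≈0) ⟩
    p′                        ∎
    where
    open import Relation.Binary.Reasoning.Setoid ≈-setoid
    x≈[x-y]+y : ∀ x y → x ≈ (x +ₚ negₚ y) +ₚ y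
    x≈[x-y]+y = solve-∀ Poly-ring
    [x-y]z≈xz-yz : ∀ x y z → (x +ₚ negₚ y) *ₚ z ≈ x *ₚ z +ₚ negₚ (y *ₚ z)
    [x-y]z≈xz-yz = solve-∀ Poly-ring
    difference≈0 : (p +ₚ negₚ p′) *ₚ q ≈ []
    difference≈0 = begin
      (p +ₚ negₚ p′) *ₚ q         ≈⟨ [x-y]z≈xz-yz p p′ q ⟩
      p *ₚ q +ₚ negₚ (p′ *ₚ q)    ≈⟨ +-congˡ _ e ⟩
      p′ *ₚ q +ₚ negₚ (p′ *ₚ q)   ≈⟨ +-inverseʳ (p′ *ₚ q) ⟩
      []                          ∎

  sum-++ : ∀ ps qs → sumₚ (ps ++ qs) ≈ sumₚ ps +ₚ sumₚ qs
  sum-++ []       qs = ≈-refl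
  sum-++ (p ∷ ps) qs = ≈-trans (+-congʳ p (sum-++ ps qs)) (≈-sym (+-assoc p _ _))


module QBinomial where

  open Polynomial
  open import Relation.Binary.Reasoning.Setoid ≈-setoid

  qbin : ℕ → ℕ → Poly
  qbin a       zero    = 1ₚ
  qbin zero    (suc b) = 1ₚ
  qbin (suc a) (suc b) = qbin (suc a) b +ₚ qpow (suc b) *ₚ qbin a (suc b)

  qbin-0ˡ : ∀ b → qbin 0 b ≡ 1ₚ
  qbin-0ˡ zero    = refl
  qbin-0ˡ (suc b) = refl

  qint-+ : ∀ m n → qint (m ℕ.+ n) ≈ qint m +ₚ qpow m *ₚ qint n
  qint-+ zero    n = ≈-sym (*-identityˡ (qint n))
  qint-+ (suc m) n = ≈-sym (≈-trans (+-congʳ (qint (suc m)) (0∷-* (qpow m) (qint n)))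
                                    (∷-cong refl (≈-sym (qint-+ m n))))

  qbin-fact : ∀ a b → qbin a b *ₚ qfact a *ₚ qfact b ≈ qfact (a ℕ.+ b)
  qbin-fact a       zero    = begin
    1ₚ *ₚ qfact a *ₚ 1ₚ  ≈⟨ ≈-trans (*-identityʳ _) (*-identityˡ (qfact a)) ⟩
    qfact a              ≡⟨ cong qfact (sym (ℕP.+-identityʳ a)) ⟩
    qfact (a ℕ.+ 0)      ∎
  qbin-fact zero    (suc b) = ≈-trans (*-congˡ _ (*-identityˡ 1ₚ)) (*-identityˡ _)
  qbin-fact (suc a) (suc b) = begin
    (X +ₚ qpow (suc b) *ₚ Y) *ₚ ([a+1] *ₚ [a]!) *ₚ ([b+1] *ₚ [b]!)
      ≈⟨ rearrange X (qpow (suc b)) Y [a+1] [a]! [b+1] [b]! ⟩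
    (X *ₚ ([a+1] *ₚ [a]!) *ₚ [b]!) *ₚ [b+1] +ₚ qpow (suc b) *ₚ (Y *ₚ [a]! *ₚ ([b+1] *ₚ [b]!)) *ₚ [a+1]
      ≈⟨ +-cong (*-congˡ [b+1] (≈-trans (qbin-fact (suc a) b) (≡⇒≈ (cong qfact (sym (ℕP.+-suc a b))))))
                (*-congˡ [a+1] (*-congʳ (qpow (suc b)) (qbin-fact a (suc b)))) ⟩
    F *ₚ [b+1] +ₚ qpow (suc b) *ₚ F *ₚ [a+1]
      ≈⟨ factor F [b+1] (qpow (suc b)) [a+1] ⟩
    ([b+1] +ₚ qpow (suc b) *ₚ [a+1]) *ₚ F
      ≈⟨ *-congˡ F (≈-sym (qint-+ (suc b) (suc a))) ⟩
    qint (suc b ℕ.+ suc a) *ₚ F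
      ≡⟨ cong (λ n → qint n *ₚ F) (ℕP.+-comm (suc b) (suc a)) ⟩
    qint (suc a ℕ.+ suc b) *ₚ F ∎
    where
    X = qbin (suc a) b
    Y = qbin a (suc b)
    F = qfact (a ℕ.+ suc b)
    [a+1] = qint (suc a)
    [b+1] = qint (suc b)
    [a]! = qfact a
    [b]! = qfact b
    rearrange : ∀ x q y ia fa ib fb →
      (x +ₚ q *ₚ y) *ₚ (ia *ₚ fa) *ₚ (ib *ₚ fb)
        ≈ (x *ₚ (ia *ₚ fa) *ₚ fb) *ₚ ib +ₚ q *ₚ (y *ₚ fa *ₚ (ib *ₚ fb)) *ₚ ia
    rearrange = solve-∀ Poly-ring
    factor : ∀ f ib q ia → f *ₚ ib +ₚ q *ₚ f *ₚ ia ≈ (ib +ₚ q *ₚ ia) *ₚ f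
    factor = solve-∀ Poly-ring

  qbin-isQBinomial : ∀ a b → IsQBinomial (qbin a b)
  qbin-isQBinomial a b = a , b , get (qbin-fact a b)

module Products {R : Poly → Set} where

  open Polynomial

  IsProductOf-intro : ∀ {p} ps → All R ps → p ≈ prodₚ ps → IsProductOf R p
  IsProductOf-intro ps rs (mk p≈∏ps) = ps , rs , p≈∏ps

  factors-≈ : ∀ {p} → ((ps , _ , _) : IsProductOf R p) → p ≈ prodₚ ps
  factors-≈ {p} (ps , _ , p≈∏ps) = mk {p} {prodₚ ps} p≈∏ps

  IsProductOf-resp : ∀ {p q} → p ≈ q → IsProductOf R p → IsProductOf R q
  IsProductOf-resp {p} p≈q ∏@(ps , rs , _) = IsProductOf-intro ps rs (≈-trans (≈-sym p≈q) (factors-≈ {p} ∏))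

  IsProductOf-1ₚ : IsProductOf R 1ₚ
  IsProductOf-1ₚ = IsProductOf-intro [] [] ≈-refl

  IsProductOf-single : ∀ {p} → R p → IsProductOf R p
  IsProductOf-single {p} r = IsProductOf-intro (p ∷ []) (r ∷ []) (≈-sym (*-identityʳ p))

  IsProductOf-* : ∀ {p q} → IsProductOf R p → IsProductOf R q → IsProductOf R (p *ₚ q)
  IsProductOf-* {p} {q} ∏p@(ps , rs , _) ∏q@(qs , ss , _) = IsProductOf-intro (ps ++ qs) (AllP.++⁺ rs ss)
    (≈-trans (*-cong (factors-≈ {p} ∏p) (factors-≈ {q} ∏q)) (≈-sym (prod-++ ps qs)))

  IsProductOf-refine : ∀ {R′ : Poly → Set} → (∀ p → R′ p → IsProductOf R p) →
                       ∀ {p} → IsProductOf R′ p → IsProductOf R p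
  IsProductOf-refine {R′} R′⇒∏R {p} (ps , rs , p≈∏ps) =
    IsProductOf-resp {prodₚ ps} (≈-sym (mk {p} p≈∏ps)) (∏R ps rs)
    where
    ∏R : ∀ ps → All R′ ps → IsProductOf R (prodₚ ps)
    ∏R []       []       = IsProductOf-1ₚ
    ∏R (p ∷ ps) (r ∷ rs) = IsProductOf-* {p} (R′⇒∏R p r) (∏R ps rs)

module PluckingPolynomial where

  open Polynomial
  open QBinomial
  open import Relation.Binary.Reasoning.Setoid ≈-setoid

  Qs : List Tree → Poly
  Qs ts = Q (node ts)

  qSum : {A : Set} → (A → ℕ) → (A → Poly) → List A → Poly
  qSum r f xs = sumₚ (map (λ x → shiftₚ (r x) (f x)) xs)

  module _ {A : Set} where

    qSum-++ : ∀ r f (xs ys : List A) → qSum r f (xs ++ ys) ≈ qSum r f xs +ₚ qSum r f ys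
    qSum-++ r f xs ys = ≈-trans (≡⇒≈ (cong sumₚ (ListP.map-++ _ xs ys))) (sum-++ (map _ xs) _)

    qSum-map : ∀ {B : Set} r f (g : B → A) xs → qSum r f (map g xs) ≡ qSum (λ x → r (g x)) (λ x → f (g x)) xs
    qSum-map r f g xs = cong sumₚ (sym (ListP.map-∘ xs))

    qSum-factor : ∀ r {f g} c (xs : List A) → All (λ x → f x ≈ c *ₚ g x) xs → qSum r f xs ≈ c *ₚ qSum r g xs
    qSum-factor r c []       []       = ≈-sym (*-zeroʳ c)
    qSum-factor r {f} {g} c (x ∷ xs) (e ∷ es) = begin
      shiftₚ (r x) (f x) +ₚ qSum r f xs
        ≈⟨ +-cong (≈-trans (shift≈qpow* (r x) (f x)) (*-congʳ (qpow (r x)) e)) (qSum-factor r c xs es) ⟩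
      qpow (r x) *ₚ (c *ₚ g x) +ₚ c *ₚ qSum r g xs
        ≈⟨ pull-out (qpow (r x)) c (g x) (qSum r g xs) ⟩
      c *ₚ (qpow (r x) *ₚ g x +ₚ qSum r g xs)
        ≈⟨ *-congʳ c (+-congˡ _ (≈-sym (shift≈qpow* (r x) (g x)))) ⟩
      c *ₚ (shiftₚ (r x) (g x) +ₚ qSum r g xs) ∎
      where
      pull-out : ∀ p c y s → p *ₚ (c *ₚ y) +ₚ c *ₚ s ≈ c *ₚ (p *ₚ y +ₚ s)
      pull-out = solve-∀ Poly-ring

    qSum-+ʳ : ∀ r f b (xs : List A) → qSum (λ x → r x ℕ.+ b) f xs ≈ qpow b *ₚ qSum r f xs
    qSum-+ʳ r f b []       = ≈-sym (*-zeroʳ (qpow b))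
    qSum-+ʳ r f b (x ∷ xs) = begin
      shiftₚ (r x ℕ.+ b) (f x) +ₚ qSum (λ x → r x ℕ.+ b) f xs
        ≈⟨ +-cong (≈-trans (shift≈qpow* (r x ℕ.+ b) (f x)) (*-congˡ (f x) (qpow-+ (r x) b))) (qSum-+ʳ r f b xs) ⟩
      (qpow (r x) *ₚ qpow b) *ₚ f x +ₚ qpow b *ₚ qSum r f xs
        ≈⟨ pull-out (qpow (r x)) (qpow b) (f x) (qSum r f xs) ⟩
      qpow b *ₚ (qpow (r x) *ₚ f x +ₚ qSum r f xs)
        ≈⟨ *-congʳ (qpow b) (+-congˡ _ (≈-sym (shift≈qpow* (r x) (f x)))) ⟩
      qpow b *ₚ (shiftₚ (r x) (f x) +ₚ qSum r f xs) ∎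
      where
      pull-out : ∀ p c y s → (p *ₚ c) *ₚ y +ₚ c *ₚ s ≈ c *ₚ (p *ₚ y +ₚ s)
      pull-out = solve-∀ Poly-ring

  pluckSum : List (ℕ × List Tree) → Poly
  pluckSum = qSum proj₁ (λ (_ , ts′) → Qs ts′)

  plucks-edges : ∀ ts → All (λ (_ , ts′) → suc (edgesL ts′) ≡ edgesL ts) (plucks ts)
  plucks-edges []                   = []
  plucks-edges (node [] ∷ ts)       = refl ∷ AllP.map⁺ (All.map (cong suc) (plucks-edges ts))
  plucks-edges (node (c ∷ cs) ∷ ts) = AllP.++⁺
    (AllP.map⁺ (All.map (λ e → cong (λ n → suc (n ℕ.+ edgesL ts)) e) (plucks-edges (c ∷ cs))))
    (AllP.map⁺ (All.map (λ {(_ , ts′)} e → cong suc (trans (sym (ℕP.+-suc (edgesL (c ∷ cs)) (edgesL ts′)))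
                                                          (cong (edgesL (c ∷ cs) ℕ.+_) e)))
                        (plucks-edges ts)))

  -- The fuel in Q always suffices: plucking a leaf removes exactly one edge.
  Q-unfold : ∀ t ts → Qs (t ∷ ts) ≡ pluckSum (plucks (t ∷ ts))
  Q-unfold t ts = go (plucks (t ∷ ts)) (plucks-edges (t ∷ ts))
    where
    go : ∀ xs → All (λ (_ , ts′) → suc (edgesL ts′) ≡ edgesL (t ∷ ts)) xs →
         sumₚ (map (λ (r , T′) → shiftₚ r (Qfuel (edges t ℕ.+ edgesL ts) T′)) (map (λ (r , ts′) → (r , node ts′)) xs))
         ≡ pluckSum xs
    go []              []       = refl
    go ((r , ts′) ∷ xs) (e ∷ es) =
      cong₂ (λ n rest → shiftₚ r (Qfuel n (node ts′)) +ₚ rest) (sym (ℕP.suc-injective e)) (go xs es)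

  qSum-plucks : ∀ t ts {g : List Tree → Poly} c →
    (∀ ts′ → suc (edgesL ts′) ≡ edgesL (t ∷ ts) → g ts′ ≈ c *ₚ Qs ts′) →
    qSum proj₁ (λ (_ , ts′) → g ts′) (plucks (t ∷ ts)) ≈ c *ₚ Qs (t ∷ ts)
  qSum-plucks t ts c g≈cQ = begin
    qSum proj₁ _ (plucks (t ∷ ts))
      ≈⟨ qSum-factor proj₁ c _ (All.map (λ {(_ , ts′)} → g≈cQ ts′) (plucks-edges (t ∷ ts))) ⟩
    c *ₚ pluckSum (plucks (t ∷ ts))
      ≡⟨ cong (c *ₚ_) (sym (Q-unfold t ts)) ⟩
    c *ₚ Qs (t ∷ ts) ∎

  -- The leaves of node (t ∷ ts) lying in the leftmost branch (t itself if it is a leaf),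
  -- and those lying in the other branches ts.
  plucksHead : Tree → List Tree → List (ℕ × List Tree)
  plucksHead (node [])       ts = (edgesL ts , ts) ∷ []
  plucksHead (node (c ∷ cs)) ts = map (λ (r , cs′) → (r ℕ.+ edgesL ts , node cs′ ∷ ts)) (plucks (c ∷ cs))

  plucksTail : Tree → List Tree → List (ℕ × List Tree)
  plucksTail t ts = map (λ (r , ts′) → (r , t ∷ ts′)) (plucks ts)

  plucks-∷ : ∀ t ts → plucks (t ∷ ts) ≡ plucksHead t ts ++ plucksTail t ts
  plucks-∷ (node [])       ts = refl
  plucks-∷ (node (c ∷ cs)) ts = refl

  Factorises : Tree → List Tree → Set
  Factorises t ts = Qs (t ∷ ts) ≈ qbin (suc (edges t)) (edgesL ts) *ₚ (Q t *ₚ Qs ts)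

  module InductionStep (n : ℕ) (ih : ∀ t ts → edgesL (t ∷ ts) ≡ n → Factorises t ts) where

    headSum : ∀ t ts → edges t ℕ.+ edgesL ts ≡ n →
      pluckSum (plucksHead t ts)
        ≈ qpow (edgesL ts) *ₚ (qbin (edges t) (edgesL ts) *ₚ (Q t *ₚ Qs ts))
    headSum (node []) ts _ = begin
      shiftₚ b (Qs ts) +ₚ []             ≈⟨ ≈-trans (+-identityʳ _) (shift≈qpow* b (Qs ts)) ⟩
      qpow b *ₚ Qs ts                    ≈⟨ *-congʳ (qpow b) (≈-sym (≈-trans (*-identityˡ _) (*-identityˡ _))) ⟩
      qpow b *ₚ (1ₚ *ₚ (1ₚ *ₚ Qs ts))    ≡⟨ cong (λ p → qpow b *ₚ (p *ₚ (1ₚ *ₚ Qs ts))) (sym (qbin-0ˡ b)) ⟩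
      qpow b *ₚ (qbin 0 b *ₚ (1ₚ *ₚ Qs ts)) ∎
      where b = edgesL ts
    headSum t@(node (c ∷ cs)) ts a+b≡n = begin
      pluckSum (map (λ (r , cs′) → (r ℕ.+ b , node cs′ ∷ ts)) (plucks (c ∷ cs)))
        ≡⟨ qSum-map proj₁ (λ (_ , ts′) → Qs ts′) _ (plucks (c ∷ cs)) ⟩
      qSum (λ (r , _) → r ℕ.+ b) (λ (_ , cs′) → Qs (node cs′ ∷ ts)) (plucks (c ∷ cs))
        ≈⟨ qSum-+ʳ proj₁ _ b (plucks (c ∷ cs)) ⟩
      qpow b *ₚ qSum proj₁ (λ (_ , cs′) → Qs (node cs′ ∷ ts)) (plucks (c ∷ cs))
        ≈⟨ *-congʳ (qpow b) (qSum-plucks c cs (qbin a b *ₚ Qs ts) pluck-factorises) ⟩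
      qpow b *ₚ ((qbin a b *ₚ Qs ts) *ₚ Q t)
        ≈⟨ *-congʳ (qpow b) (rearrange (qbin a b) (Qs ts) (Q t)) ⟩
      qpow b *ₚ (qbin a b *ₚ (Q t *ₚ Qs ts)) ∎
      where
      a = edges t
      b = edgesL ts
      rearrange : ∀ x y z → (x *ₚ y) *ₚ z ≈ x *ₚ (z *ₚ y)
      rearrange = solve-∀ Poly-ring
      pluck-factorises : ∀ cs′ → suc (edgesL cs′) ≡ a → Qs (node cs′ ∷ ts) ≈ (qbin a b *ₚ Qs ts) *ₚ Qs cs′
      pluck-factorises cs′ e = begin
        Qs (node cs′ ∷ ts)                         ≈⟨ ih (node cs′) ts (trans (cong (ℕ._+ b) e) a+b≡n) ⟩
        qbin (suc (edgesL cs′)) b *ₚ (Qs cs′ *ₚ Qs ts) ≡⟨ cong (λ k → qbin k b *ₚ (Qs cs′ *ₚ Qs ts)) e ⟩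
        qbin a b *ₚ (Qs cs′ *ₚ Qs ts)              ≈⟨ rearrange′ (qbin a b) (Qs cs′) (Qs ts) ⟩
        (qbin a b *ₚ Qs ts) *ₚ Qs cs′              ∎
        where
        rearrange′ : ∀ x y z → x *ₚ (y *ₚ z) ≈ (x *ₚ z) *ₚ y
        rearrange′ = solve-∀ Poly-ring

    tailSum : ∀ t t₂ ts → edges t ℕ.+ edgesL (t₂ ∷ ts) ≡ n →
      pluckSum (plucksTail t (t₂ ∷ ts))
        ≈ qbin (suc (edges t)) (edges t₂ ℕ.+ edgesL ts) *ₚ (Q t *ₚ Qs (t₂ ∷ ts))
    tailSum t t₂ ts a+b≡n = begin
      pluckSum (plucksTail t (t₂ ∷ ts))
        ≡⟨ qSum-map proj₁ (λ (_ , ts′) → Qs ts′) _ (plucks (t₂ ∷ ts)) ⟩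
      qSum proj₁ (λ (_ , ts′) → Qs (t ∷ ts′)) (plucks (t₂ ∷ ts))
        ≈⟨ qSum-plucks t₂ ts (qbin (suc a) b′ *ₚ Q t) pluck-factorises ⟩
      (qbin (suc a) b′ *ₚ Q t) *ₚ Qs (t₂ ∷ ts)
        ≈⟨ *-assoc (qbin (suc a) b′) (Q t) (Qs (t₂ ∷ ts)) ⟩
      qbin (suc a) b′ *ₚ (Q t *ₚ Qs (t₂ ∷ ts)) ∎
      where
      a = edges t
      b′ = edges t₂ ℕ.+ edgesL ts
      pluck-factorises : ∀ ts′ → suc (edgesL ts′) ≡ suc b′ → Qs (t ∷ ts′) ≈ (qbin (suc a) b′ *ₚ Q t) *ₚ Qs ts′
      pluck-factorises ts′ e = begin
        Qs (t ∷ ts′)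
          ≈⟨ ih t ts′ (trans (sym (ℕP.+-suc a (edgesL ts′))) (trans (cong (a ℕ.+_) e) a+b≡n)) ⟩
        qbin (suc a) (edgesL ts′) *ₚ (Q t *ₚ Qs ts′)
          ≡⟨ cong (λ k → qbin (suc a) k *ₚ (Q t *ₚ Qs ts′)) (ℕP.suc-injective e) ⟩
        qbin (suc a) b′ *ₚ (Q t *ₚ Qs ts′)
          ≈⟨ ≈-sym (*-assoc (qbin (suc a) b′) (Q t) (Qs ts′)) ⟩
        (qbin (suc a) b′ *ₚ Q t) *ₚ Qs ts′ ∎

    factorises : ∀ t ts → edges t ℕ.+ edgesL ts ≡ n → Factorises t ts
    factorises t [] a+0≡n = begin
      Qs (t ∷ [])                       ≡⟨ trans (Q-unfold t []) (cong pluckSum (plucks-∷ t [])) ⟩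
      pluckSum (plucksHead t [] ++ [])  ≡⟨ cong pluckSum (ListP.++-identityʳ (plucksHead t [])) ⟩
      pluckSum (plucksHead t [])        ≈⟨ headSum t [] a+0≡n ⟩
      1ₚ *ₚ (1ₚ *ₚ (Q t *ₚ 1ₚ))         ≈⟨ *-identityˡ _ ⟩
      1ₚ *ₚ (Q t *ₚ 1ₚ)                 ∎
    factorises t ts@(t₂ ∷ ts₂) a+b≡n = begin
      Qs (t ∷ ts)
        ≡⟨ trans (Q-unfold t ts) (cong pluckSum (plucks-∷ t ts)) ⟩
      pluckSum (plucksHead t ts ++ plucksTail t ts)
        ≈⟨ qSum-++ proj₁ _ (plucksHead t ts) _ ⟩
      pluckSum (plucksHead t ts) +ₚ pluckSum (plucksTail t ts)
        ≈⟨ +-cong (headSum t ts a+b≡n) (tailSum t t₂ ts₂ a+b≡n) ⟩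
      qpow b *ₚ (qbin a b *ₚ X) +ₚ qbin (suc a) b′ *ₚ X
        ≈⟨ collect (qpow b) (qbin a b) (qbin (suc a) b′) X ⟩
      (qbin (suc a) b′ +ₚ qpow b *ₚ qbin a b) *ₚ X
        ≡⟨⟩ -- the q-Pascal rule, as b = suc b′
      qbin (suc a) b *ₚ X ∎
      where
      a = edges t
      b = edgesL ts
      b′ = edges t₂ ℕ.+ edgesL ts₂
      X = Q t *ₚ Qs ts
      collect : ∀ p x y z → p *ₚ (x *ₚ z) +ₚ y *ₚ z ≈ (y +ₚ p *ₚ x) *ₚ z
      collect = solve-∀ Poly-ring

  Q-∷ : ∀ t ts → Factorises t ts
  Q-∷ t ts = by-size _ t ts refl
    where
    by-size : ∀ n t ts → edgesL (t ∷ ts) ≡ n → Factorises t ts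
    by-size zero    t ts ()
    by-size (suc n) t ts e = InductionStep.factorises n (by-size n) t ts (ℕP.suc-injective e)

  Q-isProductOfQBinomials : ∀ T → IsProductOf IsQBinomial (Q T)
  Q-isProductOfQBinomials (node ts) = Qs-isProduct ts
    where
    open Products
    Qs-isProduct : ∀ ts → IsProductOf IsQBinomial (Qs ts)
    Qs-isProduct []              = IsProductOf-1ₚ
    Qs-isProduct (t@(node cs) ∷ ts) = IsProductOf-resp {p = B *ₚ (Qs cs *ₚ Qs ts)} (≈-sym (Q-∷ t ts))
      (IsProductOf-* {p = B} (IsProductOf-single {p = B} (qbin-isQBinomial (suc (edges t)) (edgesL ts)))
                         (IsProductOf-* {p = Qs cs} (Qs-isProduct cs) (Qs-isProduct ts)))
      where B = qbin (suc (edges t)) (edgesL ts)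

module Multiples where

  open import Data.Nat using (_*_; _+_)
  open ℕP using (≤-<-trans; <-≤-trans; *-cancelʳ-<; *-monoˡ-≤; +-monoˡ-≤; n<1+n; m≤n⇒m≤1+n; ≤∧≢⇒<)

  [_∣_] : ℕ → ℕ → ℕ
  [ d ∣ k ] with d ∣? k
  ... | yes _ = 1
  ... | no  _ = 0

  multiples : ℕ → ℕ → ℕ
  multiples zero    d = 0
  multiples (suc n) d = [ d ∣ suc n ] + multiples n d

  multiples-0 : ∀ n → multiples n 0 ≡ 0
  multiples-0 zero    = refl
  multiples-0 (suc n) with 0 ∣? suc n
  ... | yes 0∣n+1 = ⊥-elim (ℕP.1+n≢0 (0∣⇒≡0 0∣n+1))
  ... | no  _     = multiples-0 n

  multiples-floor : ∀ n d → let D = suc d; c = multiples n D in c * D ≤ n × n < suc c * D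
  multiples-floor zero    d = z≤n , s≤s z≤n
  multiples-floor (suc n) d with suc d ∣? suc n | multiples-floor n d
  ... | yes (divides k n+1≡kD) | (cD≤n , n<[c+1]D) =
    subst (suc c * D ≤_) (sym n+1≡kD) (*-monoˡ-≤ D c<k) ,
    <-≤-trans (s≤s n<[c+1]D) (+-monoˡ-≤ (suc c * D) (s≤s (z≤n {d})))
    where
    D = suc d
    c = multiples n D
    c<k : c < k
    c<k = *-cancelʳ-< D c k (≤-<-trans cD≤n (subst (n <_) n+1≡kD (n<1+n n)))
  ... | no ¬D∣n+1 | (cD≤n , n<[c+1]D) =
    m≤n⇒m≤1+n cD≤n ,
    ≤∧≢⇒< n<[c+1]D (λ n+1≡[c+1]D → ¬D∣n+1 (divides (suc (multiples n (suc d))) n+1≡[c+1]D))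

  multiples-superadditive : ∀ a b d → multiples a d + multiples b d ≤ multiples (a + b) d
  multiples-superadditive a b zero
    rewrite multiples-0 a | multiples-0 b | multiples-0 (a + b) = z≤n
  multiples-superadditive a b (suc d) = ℕ.s≤s⁻¹ (*-cancelʳ-< D (ca + cb) (suc cab) [ca+cb]D<[cab+1]D)
    where
    D = suc d
    ca = multiples a D
    cb = multiples b D
    cab = multiples (a + b) D
    [ca+cb]D<[cab+1]D : (ca + cb) * D < suc cab * D
    [ca+cb]D<[cab+1]D = ≤-<-trans
      (subst (_≤ a + b) (sym (ℕP.*-distribʳ-+ D ca cb))
             (ℕP.+-mono-≤ (proj₁ (multiples-floor a d)) (proj₁ (multiples-floor b d))))
      (proj₂ (multiples-floor (a + b) d))

module PowersMinusOne where

  open Polynomial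
  open QBinomial using (qint-+)
  open import Relation.Binary.Reasoning.Setoid ≈-setoid

  _^ₚ_ : Poly → ℕ → Poly
  p ^ₚ n = prodₚ (replicate n p)

  ^ₚ-+ : ∀ p m n → p ^ₚ (m ℕ.+ n) ≈ p ^ₚ m *ₚ p ^ₚ n
  ^ₚ-+ p zero    n = ≈-sym (*-identityˡ _)
  ^ₚ-+ p (suc m) n = ≈-trans (*-congʳ p (^ₚ-+ p m n)) (≈-sym (*-assoc p (p ^ₚ m) (p ^ₚ n)))

  -1ₚ : Poly
  -1ₚ = -[1+ 0 ] ∷ []

  q-1 : Poly
  q-1 = qpow 1 +ₚ -1ₚ

  qpow-1≈q-1*qint : ∀ k → qpow k +ₚ -1ₚ ≈ q-1 *ₚ qint k
  qpow-1≈q-1*qint zero    = ≈-trans (∷-≈[] refl ≈-refl) (≈-sym (*-zeroʳ q-1))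
  qpow-1≈q-1*qint (suc k) = begin
    qpow (suc k) +ₚ -1ₚ                          ≈⟨ +-congˡ -1ₚ (qpow-+ 1 k) ⟩
    qpow 1 *ₚ qpow k +ₚ -1ₚ                      ≈⟨ split (qpow 1) (qpow k) ⟩
    qpow 1 *ₚ (qpow k +ₚ -1ₚ) +ₚ q-1             ≈⟨ +-congˡ q-1 (*-congʳ (qpow 1) (qpow-1≈q-1*qint k)) ⟩
    qpow 1 *ₚ (q-1 *ₚ qint k) +ₚ q-1             ≈⟨ factor (qpow 1) q-1 (qint k) ⟩
    q-1 *ₚ (1ₚ +ₚ qpow 1 *ₚ qint k)              ≈⟨ *-congʳ q-1 (≈-sym (qint-+ 1 k)) ⟩
    q-1 *ₚ qint (suc k)                          ∎
    where
    split : ∀ q p → q *ₚ p +ₚ negₚ 1ₚ ≈ q *ₚ (p +ₚ negₚ 1ₚ) +ₚ (q +ₚ negₚ 1ₚ)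
    split = solve-∀ Poly-ring
    factor : ∀ q r i → q *ₚ (r *ₚ i) +ₚ r ≈ r *ₚ (1ₚ +ₚ q *ₚ i)
    factor = solve-∀ Poly-ring

  ∏[qᵏ-1] : ℕ → Poly
  ∏[qᵏ-1] zero    = 1ₚ
  ∏[qᵏ-1] (suc n) = (qpow (suc n) +ₚ -1ₚ) *ₚ ∏[qᵏ-1] n

  ∏[qᵏ-1]≈[q-1]ⁿ*qfact : ∀ n → ∏[qᵏ-1] n ≈ q-1 ^ₚ n *ₚ qfact n
  ∏[qᵏ-1]≈[q-1]ⁿ*qfact zero    = ≈-sym (*-identityˡ 1ₚ)
  ∏[qᵏ-1]≈[q-1]ⁿ*qfact (suc n) = begin
    (qpow (suc n) +ₚ -1ₚ) *ₚ ∏[qᵏ-1] n             ≈⟨ *-cong (qpow-1≈q-1*qint (suc n)) (∏[qᵏ-1]≈[q-1]ⁿ*qfact n) ⟩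
    (q-1 *ₚ qint (suc n)) *ₚ (q-1 ^ₚ n *ₚ qfact n) ≈⟨ interchange q-1 (qint (suc n)) (q-1 ^ₚ n) (qfact n) ⟩
    (q-1 *ₚ q-1 ^ₚ n) *ₚ (qint (suc n) *ₚ qfact n) ∎
    where
    interchange : ∀ w x y z → (w *ₚ x) *ₚ (y *ₚ z) ≈ (w *ₚ y) *ₚ (x *ₚ z)
    interchange = solve-∀ Poly-ring

  ∏[qᵏ-1]-constNonZero : ∀ n → ConstNonZero (∏[qᵏ-1] n)
  ∏[qᵏ-1]-constNonZero zero    ()
  ∏[qᵏ-1]-constNonZero (suc n) = ConstNonZero-* (qpow (suc n) +ₚ -1ₚ) (∏[qᵏ-1] n) (λ ()) (∏[qᵏ-1]-constNonZero n)

  qbin-∏[qᵏ-1] : ∀ {P} a b → P *ₚ qfact a *ₚ qfact b ≈ qfact (a ℕ.+ b) →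
                 P *ₚ (∏[qᵏ-1] a *ₚ ∏[qᵏ-1] b) ≈ ∏[qᵏ-1] (a ℕ.+ b)
  qbin-∏[qᵏ-1] {P} a b P[a]![b]!≈[a+b]! = begin
    P *ₚ (∏[qᵏ-1] a *ₚ ∏[qᵏ-1] b)
      ≈⟨ *-congʳ P (*-cong (∏[qᵏ-1]≈[q-1]ⁿ*qfact a) (∏[qᵏ-1]≈[q-1]ⁿ*qfact b)) ⟩
    P *ₚ ((q-1 ^ₚ a *ₚ qfact a) *ₚ (q-1 ^ₚ b *ₚ qfact b))
      ≈⟨ rearrange P (qfact a) (qfact b) (q-1 ^ₚ a) (q-1 ^ₚ b) ⟩
    (P *ₚ qfact a *ₚ qfact b) *ₚ (q-1 ^ₚ a *ₚ q-1 ^ₚ b)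
      ≈⟨ *-cong P[a]![b]!≈[a+b]! (≈-sym (^ₚ-+ q-1 a b)) ⟩
    qfact (a ℕ.+ b) *ₚ q-1 ^ₚ (a ℕ.+ b)
      ≈⟨ ≈-trans (*-comm (qfact (a ℕ.+ b)) _) (≈-sym (∏[qᵏ-1]≈[q-1]ⁿ*qfact (a ℕ.+ b))) ⟩
    ∏[qᵏ-1] (a ℕ.+ b) ∎
    where
    rearrange : ∀ p fa fb ea eb → p *ₚ ((ea *ₚ fa) *ₚ (eb *ₚ fb)) ≈ (p *ₚ fa *ₚ fb) *ₚ (ea *ₚ eb)
    rearrange = solve-∀ Poly-ring

module Cyclotomic (C : ℕ → Poly) (C-cyclotomic : IsCyclotomicFamily C) where

  open Polynomial
  open Multiples
  open PowersMinusOne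
  open import Relation.Binary.Reasoning.Setoid ≈-setoid

  IsCyclotomic : Poly → Set
  IsCyclotomic P = Σ ℕ λ n → (n ≥ 1) × (P ≡ C n)

  upTo₁ : ℕ → List ℕ
  upTo₁ k = map suc (upTo k)

  upTo₁-suc : ∀ k → upTo₁ (suc k) ≡ upTo₁ k ++ (suc k ∷ [])
  upTo₁-suc k = trans (cong (map suc) (sym (ListP.upTo-∷ʳ k))) (ListP.map-++ suc (upTo k) (k ∷ []))

  cycFactors : List ℕ → (ℕ → ℕ) → List Poly
  cycFactors []       e = []
  cycFactors (d ∷ ds) e = replicate (e d) (C d) ++ cycFactors ds e

  cycProduct : List ℕ → (ℕ → ℕ) → Poly
  cycProduct ds e = prodₚ (cycFactors ds e)

  cycFactors-++ : ∀ ds ds′ e → cycFactors (ds ++ ds′) e ≡ cycFactors ds e ++ cycFactors ds′ e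
  cycFactors-++ []       ds′ e = refl
  cycFactors-++ (d ∷ ds) ds′ e = trans (cong (replicate (e d) (C d) ++_) (cycFactors-++ ds ds′ e))
                                       (sym (ListP.++-assoc (replicate (e d) (C d)) _ _))

  cycFactors-cong : ∀ ds {e e′} → (∀ d → e d ≡ e′ d) → cycFactors ds e ≡ cycFactors ds e′
  cycFactors-cong []       e≗e′ = refl
  cycFactors-cong (d ∷ ds) e≗e′ = cong₂ (λ m fs → replicate m (C d) ++ fs) (e≗e′ d) (cycFactors-cong ds e≗e′)

  cycFactors-isCyclotomic : ∀ k e → All IsCyclotomic (cycFactors (upTo₁ k) e)
  cycFactors-isCyclotomic k e = go (upTo k)
    where
    go : ∀ ds → All IsCyclotomic (cycFactors (map suc ds) e)
    go []       = []
    go (d ∷ ds) = AllP.++⁺ (AllP.replicate⁺ (e (suc d)) (suc d , s≤s z≤n , refl)) (go ds)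

  cycProduct-+ : ∀ ds e e′ → cycProduct ds (λ d → e d ℕ.+ e′ d) ≈ cycProduct ds e *ₚ cycProduct ds e′
  cycProduct-+ []       e e′ = ≈-sym (*-identityˡ 1ₚ)
  cycProduct-+ (d ∷ ds) e e′ = begin
    prodₚ (replicate (e d ℕ.+ e′ d) (C d) ++ cycFactors ds (λ d → e d ℕ.+ e′ d))
      ≈⟨ prod-++ (replicate (e d ℕ.+ e′ d) (C d)) _ ⟩
    C d ^ₚ (e d ℕ.+ e′ d) *ₚ cycProduct ds (λ d → e d ℕ.+ e′ d)
      ≈⟨ *-cong (^ₚ-+ (C d) (e d) (e′ d)) (cycProduct-+ ds e e′) ⟩
    (C d ^ₚ e d *ₚ C d ^ₚ e′ d) *ₚ (cycProduct ds e *ₚ cycProduct ds e′)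
      ≈⟨ interchange (C d ^ₚ e d) (C d ^ₚ e′ d) (cycProduct ds e) (cycProduct ds e′) ⟩
    (C d ^ₚ e d *ₚ cycProduct ds e) *ₚ (C d ^ₚ e′ d *ₚ cycProduct ds e′)
      ≈⟨ ≈-sym (*-cong (prod-++ (replicate (e d) (C d)) _) (prod-++ (replicate (e′ d) (C d)) _)) ⟩
    cycProduct (d ∷ ds) e *ₚ cycProduct (d ∷ ds) e′ ∎
    where
    interchange : ∀ w x y z → (w *ₚ x) *ₚ (y *ₚ z) ≈ (w *ₚ y) *ₚ (x *ₚ z)
    interchange = solve-∀ Poly-ring

  cycFactors-[∣] : ∀ k ds → cycFactors ds (λ d → [ d ∣ k ]) ≡ map C (filter (_∣? k) ds)
  cycFactors-[∣] k []       = refl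
  cycFactors-[∣] k (d ∷ ds) with d ∣? k
  ... | yes _ = cong (C d ∷_) (cycFactors-[∣] k ds)
  ... | no  _ = cycFactors-[∣] k ds

  cycProduct-[∣] : ∀ k m → k ≥ 1 → cycProduct (upTo₁ (k ℕ.+ m)) (λ d → [ d ∣ k ]) ≈ qpow k +ₚ -1ₚ
  cycProduct-[∣] k zero    k≥1 = begin
    cycProduct (upTo₁ (k ℕ.+ 0)) [·∣k]      ≡⟨ cong (λ n → cycProduct (upTo₁ n) [·∣k]) (ℕP.+-identityʳ k) ⟩
    cycProduct (upTo₁ k) [·∣k]              ≡⟨ cong prodₚ (cycFactors-[∣] k (upTo₁ k)) ⟩
    prodₚ (map C (divisors k))              ≈⟨ mk (C-cyclotomic k k≥1) ⟩
    qpow k +ₚ -1ₚ                           ∎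
    where [·∣k] = λ d → [ d ∣ k ]
  cycProduct-[∣] k (suc m) k≥1 = begin
    cycProduct (upTo₁ (k ℕ.+ suc m)) [·∣k]
      ≡⟨ cong (λ n → cycProduct (upTo₁ n) [·∣k]) (ℕP.+-suc k m) ⟩
    cycProduct (upTo₁ (suc (k ℕ.+ m))) [·∣k]
      ≡⟨ cong (λ ds → cycProduct ds [·∣k]) (upTo₁-suc (k ℕ.+ m)) ⟩
    prodₚ (cycFactors (upTo₁ (k ℕ.+ m) ++ (suc (k ℕ.+ m) ∷ [])) [·∣k])
      ≡⟨ cong prodₚ (cycFactors-++ (upTo₁ (k ℕ.+ m)) _ [·∣k]) ⟩
    prodₚ (cycFactors (upTo₁ (k ℕ.+ m)) [·∣k] ++ cycFactors (suc (k ℕ.+ m) ∷ []) [·∣k])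
      ≈⟨ prod-++ (cycFactors (upTo₁ (k ℕ.+ m)) [·∣k]) _ ⟩
    cycProduct (upTo₁ (k ℕ.+ m)) [·∣k] *ₚ cycProduct (suc (k ℕ.+ m) ∷ []) [·∣k]
      ≈⟨ *-cong (cycProduct-[∣] k m k≥1) no-new-factor ⟩
    (qpow k +ₚ -1ₚ) *ₚ 1ₚ
      ≈⟨ *-identityʳ _ ⟩
    qpow k +ₚ -1ₚ ∎
    where
    [·∣k] = λ d → [ d ∣ k ]
    no-new-factor : cycProduct (suc (k ℕ.+ m) ∷ []) [·∣k] ≈ 1ₚ
    no-new-factor with suc (k ℕ.+ m) ∣? k
    ... | yes d∣k = ⊥-elim (ℕP.<⇒≱ (s≤s (ℕP.m≤m+n k m)) (∣⇒≤ ⦃ ℕ.>-nonZero k≥1 ⦄ d∣k))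
    ... | no  _   = ≈-refl

  cycProduct-multiples : ∀ n m → cycProduct (upTo₁ (n ℕ.+ m)) (multiples n) ≈ ∏[qᵏ-1] n
  cycProduct-multiples zero    m = ≡⇒≈ (cong prodₚ (no-factors (upTo₁ m)))
    where
    no-factors : ∀ ds → cycFactors ds (λ _ → 0) ≡ []
    no-factors []       = refl
    no-factors (d ∷ ds) = no-factors ds
  cycProduct-multiples (suc n) m = begin
    cycProduct (upTo₁ (suc n ℕ.+ m)) (λ d → [ d ∣ suc n ] ℕ.+ multiples n d)
      ≈⟨ cycProduct-+ (upTo₁ (suc n ℕ.+ m)) (λ d → [ d ∣ suc n ]) (multiples n) ⟩
    cycProduct (upTo₁ (suc n ℕ.+ m)) (λ d → [ d ∣ suc n ]) *ₚ cycProduct (upTo₁ (suc n ℕ.+ m)) (multiples n)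
      ≡⟨ cong (λ k → cycProduct (upTo₁ (suc n ℕ.+ m)) (λ d → [ d ∣ suc n ]) *ₚ cycProduct (upTo₁ k) (multiples n))
              (sym (ℕP.+-suc n m)) ⟩
    cycProduct (upTo₁ (suc n ℕ.+ m)) (λ d → [ d ∣ suc n ]) *ₚ cycProduct (upTo₁ (n ℕ.+ suc m)) (multiples n)
      ≈⟨ *-cong (cycProduct-[∣] (suc n) m (s≤s z≤n)) (cycProduct-multiples n (suc m)) ⟩
    (qpow (suc n) +ₚ -1ₚ) *ₚ ∏[qᵏ-1] n ∎

  qbin-isCyclotomicProduct : ∀ P → IsQBinomial P → IsProductOf IsCyclotomic P
  qbin-isCyclotomicProduct P (a , b , P[a]![b]!≈[a+b]!) =
    Products.IsProductOf-intro (cycFactors (upTo₁ N) E) (cycFactors-isCyclotomic N E)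
      (*-cancelʳ P (cycProduct (upTo₁ N) E) (∏[qᵏ-1] a *ₚ ∏[qᵏ-1] b)
        (ConstNonZero-* (∏[qᵏ-1] a) (∏[qᵏ-1] b) (∏[qᵏ-1]-constNonZero a) (∏[qᵏ-1]-constNonZero b))
        P∏∏≈E∏∏)
    where
    N = a ℕ.+ b
    E : ℕ → ℕ
    E d = multiples N d ℕ.∸ (multiples a d ℕ.+ multiples b d)
    P∏∏≈E∏∏ : P *ₚ (∏[qᵏ-1] a *ₚ ∏[qᵏ-1] b) ≈ cycProduct (upTo₁ N) E *ₚ (∏[qᵏ-1] a *ₚ ∏[qᵏ-1] b)
    P∏∏≈E∏∏ = begin
      P *ₚ (∏[qᵏ-1] a *ₚ ∏[qᵏ-1] b)
        ≈⟨ qbin-∏[qᵏ-1] {P} a b (mk P[a]![b]!≈[a+b]!) ⟩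
      ∏[qᵏ-1] N
        ≈⟨ ≈-sym (cycProduct-multiples N 0) ⟩
      cycProduct (upTo₁ (N ℕ.+ 0)) (multiples N)
        ≡⟨ cong (λ n → cycProduct (upTo₁ n) (multiples N)) (ℕP.+-identityʳ N) ⟩
      cycProduct (upTo₁ N) (multiples N)
        ≡⟨ cong prodₚ (cycFactors-cong (upTo₁ N) (λ d → sym (ℕP.m∸n+n≡m (multiples-superadditive a b d)))) ⟩
      cycProduct (upTo₁ N) (λ d → E d ℕ.+ (multiples a d ℕ.+ multiples b d))
        ≈⟨ cycProduct-+ (upTo₁ N) E _ ⟩
      cycProduct (upTo₁ N) E *ₚ cycProduct (upTo₁ N) (λ d → multiples a d ℕ.+ multiples b d)
        ≈⟨ *-congʳ (cycProduct (upTo₁ N) E) (cycProduct-+ (upTo₁ N) (multiples a) (multiples b)) ⟩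
      cycProduct (upTo₁ N) E *ₚ (cycProduct (upTo₁ N) (multiples a) *ₚ cycProduct (upTo₁ N) (multiples b))
        ≈⟨ *-congʳ (cycProduct (upTo₁ N) E) (*-cong (cycProduct-multiples a b) ∏b) ⟩
      cycProduct (upTo₁ N) E *ₚ (∏[qᵏ-1] a *ₚ ∏[qᵏ-1] b) ∎
      where
      ∏b : cycProduct (upTo₁ N) (multiples b) ≈ ∏[qᵏ-1] b
      ∏b = ≈-trans (≡⇒≈ (cong (λ n → cycProduct (upTo₁ n) (multiples b)) (ℕP.+-comm a b))) (cycProduct-multiples b a)

open Products using (IsProductOf-refine)
open PluckingPolynomial using (Q-isProductOfQBinomials)
open Cyclotomic using (qbin-isCyclotomicProduct)

corollary2p4 : (T : Tree) →
    IsProductOf IsQBinomial (Q T)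
    × ((C : ℕ → Poly) → IsCyclotomicFamily C →
        IsProductOf (λ P → Σ ℕ λ n → (n ≥ 1) × (P ≡ C n)) (Q T))
corollary2p4 T =
  Q-isProductOfQBinomials T ,
  λ C C-cyclotomic → IsProductOf-refine (qbin-isCyclotomicProduct C C-cyclotomic) {Q T} (Q-isProductOfQBinomials T)
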